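{- A permutation class $\mathcal{C}$ contains only finitely many zigzag permutations if and only if $\mathcal{C}$ is monotone griddable and does not contain arbitrarily long vertical alternations.
   Context: A permutation of length $n$ is an ordering $\pi=\pi(1)\cdots\pi(n)$ of $[n]$; containment is the usual pattern containment, and a permutation class is a set of permutations closed downwards under containment. $\mathsf{Av}(21)$ is the class of increasing permutations and $\mathsf{Av}(12)$ the class of decreasing permutations. A zigzag permutation is a permutation $\pi$ of length $n$ with no $i\in[n-2]$ such that $\pi(i)\pi(i+1)\pi(i+2)$ is monotone. For a matrix $\mathcal{M}$ of permutation classes (entries possibly empty), $\mathsf{Grid}(\mathcal{M})$ is the set of permutations whose plot can be divided by horizontal and vertical lines into a grid of cells of the same dimensions as $\mathcal{M}$ such that the entries in each cell are order isomorphic to a permutation in the class in the corresponding cell of $\mathcal{M}$. A monotone grid class is $\mathsf{Grid}(\mathcal{M})$ where every entry of $\mathcal{M}$ is $\mathsf{Av}(21)$, $\mathsf{Av}(12)$ or empty; a class is monotone griddable if it is a subclass of some monotone grid class. A vertical alternation is a permutation in which every odd-indexed entry lies above every even-indexed entry, or every even-indexed entry lies above every odd-indexed entry. -}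

module Defs where

open import Data.Nat as ℕ using (ℕ; _%_)
open import Data.Fin using (Fin; toℕ; _<_; _≤_)
open import Data.List using (List; map; allFin)
open import Data.List.Membership.Propositional using (_∈_)
open import Data.Product using (Σ; ∃; _×_; _,_)
open import Data.Sum using (_⊎_)
open import Data.Empty using (⊥)
open import Function.Definitions using (Injective)
open import Relation.Binary.PropositionalEquality using (_≡_; _≢_)
open import Relation.Nullary using (¬_)

-- A permutation of length n: a bijection [n] → [n] (0-indexed; an injective
-- endofunction of a finite set), given in one-line notation π(0) ⋯ π(n-1).
record Perm (n : ℕ) : Set where
  constructor perm
  field
    fun : Fin n → Fin n
    inj : Injective _≡_ _≡_ fun
open Perm public

oneLine : ∀ {n} → Perm n → List ℕ
oneLine {n} π = map (λ i → toℕ (fun π i)) (allFin n)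

_≼_ : ∀ {k n} → Perm k → Perm n → Set
_≼_ {k} {n} σ π =
  Σ (Fin k → Fin n) λ f →
    (∀ i j → i < j → f i < f j) ×
    (∀ i j → (fun σ i < fun σ j → fun π (f i) < fun π (f j))
           × (fun π (f i) < fun π (f j) → fun σ i < fun σ j))

PermSet : Set₁
PermSet = ∀ {n} → Perm n → Set

IsClass : PermSet → Set
IsClass C = ∀ {k n} (σ : Perm k) (π : Perm n) → σ ≼ π → C π → C σ

FinitelyMany : PermSet → Set
FinitelyMany P = Σ (List (List ℕ)) λ L → ∀ {n} (π : Perm n) → P π → oneLine π ∈ L

Zigzag : PermSet
Zigzag {n} π = ∀ (i j k : Fin n) → toℕ j ≡ ℕ.suc (toℕ i) → toℕ k ≡ ℕ.suc (toℕ j) →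
  ¬ ((fun π i < fun π j × fun π j < fun π k) ⊎ (fun π k < fun π j × fun π j < fun π i))

-- vertical alternation (positions 1-indexed in the paper: odd-indexed
-- entries are those with even 0-based index)
OddIdx : ∀ {n} → Fin n → Set
OddIdx i = toℕ i % 2 ≡ 0

EvenIdx : ∀ {n} → Fin n → Set
EvenIdx i = toℕ i % 2 ≡ 1

VerticalAlternation : PermSet
VerticalAlternation {n} π =
  (∀ (i j : Fin n) → OddIdx i → EvenIdx j → fun π j < fun π i) ⊎
  (∀ (i j : Fin n) → OddIdx i → EvenIdx j → fun π i < fun π j)

BoundedVerticalAlternations : PermSet → Set
BoundedVerticalAlternations C =
  Σ ℕ λ N → ∀ {n} (π : Perm n) → C π → VerticalAlternation π → n ℕ.≤ N

-- monotone grid classes: cells are Av(21) (increasing), Av(12) (decreasing), or empty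
data Cell : Set where
  inc dec empty : Cell

Fits : ∀ {n} → Cell → Fin n → Fin n → Set
Fits inc   a b = a < b
Fits dec   a b = b < a
Fits empty a b = ⊥

-- a c × r matrix of cells, indexed by (column, row); columns left to right,
-- rows bottom to top
Matrix : ℕ → ℕ → Set
Matrix c r = Fin c → Fin r → Cell

-- π ∈ Grid(M): positions are split into c consecutive column intervals
-- (col, weakly increasing in position), values into r consecutive row intervals
-- (row, weakly increasing in value); each entry lies in a nonempty cell and
-- the entries of each cell are increasing/decreasing as prescribed.
InGrid : ∀ {c r} → Matrix c r → PermSet
InGrid {c} {r} M {n} π =
  Σ (Fin n → Fin c) λ col → Σ (Fin n → Fin r) λ row →
    (∀ i j → i ≤ j → col i ≤ col j) ×
    (∀ v w → v ≤ w → row v ≤ row w) ×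
    (∀ i → M (col i) (row (fun π i)) ≢ empty) ×
    (∀ i j → i < j → col i ≡ col j → row (fun π i) ≡ row (fun π j) →
       Fits (M (col i) (row (fun π i))) (fun π i) (fun π j))

MonotoneGriddable : PermSet → Set
MonotoneGriddable C =
  Σ ℕ λ c → Σ ℕ λ r → Σ (Matrix c r) λ M → ∀ {n} (π : Perm n) → C π → InGrid M π

_∩Zigzag : PermSet → PermSet
(C ∩Zigzag) π = C π × Zigzag π

-- Both directions pass through bounded lengths: a set of permutations is
-- finite exactly when their lengths are bounded.
--
-- (⇒) Vertical alternations are zigzags, so they are bounded. To grid π ∈ C,
-- cut it greedily into monotone runs forming columns that are alternately
-- increasing and decreasing (even columns increasing). The entries at which a
-- new column opens alternate in direction, so they form a zigzag in C; hence
-- the number of columns is bounded and π lies in a one-row grid class.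
--
-- (⇐) In a zigzag gridded by a c × r matrix no three consecutive entries share
-- a cell, so at least every other adjacent pair crosses a column or a row
-- boundary. At most c pairs cross a column boundary. The pairs stepping down
-- into a fixed row a are pairwise non-adjacent, and their entries, read left to
-- right, form a vertical alternation (upper entries above row a, lower ones in
-- it); likewise for the pairs stepping up out of row a. With alternations of
-- length at most N this bounds the length of the zigzag by 2 + 2 (c + 2 r N).

module Submission where

open import Defs
open import Data.Bool.Properties using (T-≡; T-not-≡; T-∨; T-∧; T?; ∧-identityʳ)
open import Data.Bool using (Bool; true; false; T; not; _∧_; _∨_; _xor_; if_then_else_)
open import Data.Empty using (⊥-elim)
open import Data.Fin as Fin using (Fin; toℕ; fromℕ<)
import Data.Fin.Properties as Fin
open import Data.Nat using (ℕ; zero; suc; _+_; _*_; _≤_; _<_; z≤n; s≤s; s≤s⁻¹; pred; _<ᵇ_; _≡ᵇ_; _%_; _⊔_; ⌊_/2⌋; z<s)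
open import Data.Nat.Properties
open import Data.Nat.DivMod using (m%n<n)
open import Data.List using (List; []; _∷_; length; foldr; allFin; upTo; concatMap; cartesianProductWith)
open import Data.List.Properties using (length-map; length-tabulate)
open import Data.List.Membership.Propositional using (_∈_; lose)
open import Data.List.Membership.Propositional.Properties using (∈-cartesianProductWith⁺; ∈-upTo⁺; ∈-concatMap⁺; ∈-map⁻)
open import Data.List.Relation.Unary.Any using (here; there)
open import Data.Product as Product using (Σ; ∃-syntax; _×_; _,_; proj₁; proj₂)
open import Data.Sum as Sum using (_⊎_; inj₁; inj₂)
open import Data.Unit using (tt)
open import Function.Base using (_∘_)
open import Function.Bundles using (_⇔_; mk⇔; Equivalence)
open import Relation.Binary.PropositionalEquality
open import Relation.Nullary using (¬_; yes; no)
open import Relation.Binary.Definitions using (tri<; tri≈; tri>)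

count : (ℕ → Bool) → ℕ → ℕ
count p zero    = 0
count p (suc t) = if p t then suc (count p t) else count p t

count-suc-true : ∀ {p t} → p t ≡ true → count p (suc t) ≡ suc (count p t)
count-suc-true pt rewrite pt = refl

count-suc-false : ∀ {p t} → p t ≡ false → count p (suc t) ≡ count p t
count-suc-false pt rewrite pt = refl

count-true : ∀ t → count (λ _ → true) t ≡ t
count-true zero    = refl
count-true (suc t) = cong suc (count-true t)

count-false : ∀ t → count (λ _ → false) t ≡ 0
count-false zero    = refl
count-false (suc t) = count-false t

count-≤-suc : ∀ p t → count p t ≤ count p (suc t)
count-≤-suc p t with p t
... | true  = n≤1+n _
... | false = ≤-refl

count-monoʳ : ∀ p {t u} → t ≤ u → count p t ≤ count p u
count-monoʳ p {u = zero}  z≤n = z≤n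
count-monoʳ p {u = suc u} t≤1+u with m≤n⇒m<n∨m≡n t≤1+u
... | inj₂ refl  = ≤-refl
... | inj₁ t<1+u = ≤-trans (count-monoʳ p (s≤s⁻¹ t<1+u)) (count-≤-suc p u)

_⊆_upTo_ : (ℕ → Bool) → (ℕ → Bool) → ℕ → Set
p ⊆ q upTo t = ∀ {k} → k < t → T (p k) → T (q k)

⊆-upTo-pred : ∀ {p q t} → p ⊆ q upTo suc t → p ⊆ q upTo t
⊆-upTo-pred p⊆q k<t = p⊆q (m<n⇒m<1+n k<t)

count-mono : ∀ {p q} t → p ⊆ q upTo t → count p t ≤ count q t
count-mono zero _ = z≤n
count-mono {p} {q} (suc t) p⊆q with p t | q t | p⊆q {t} ≤-refl | count-mono t (⊆-upTo-pred p⊆q)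
... | true  | true  | _      | ih = s≤s ih
... | true  | false | pt⇒qt | _  = ⊥-elim (pt⇒qt tt)
... | false | true  | _      | ih = m≤n⇒m≤1+n ih
... | false | false | _      | ih = ih

count-mono-< : ∀ {p q} t → p ⊆ q upTo t → ∀ {k} → k < t → ¬ T (p k) → T (q k) → count p t < count q t
count-mono-< {p} {q} (suc t) p⊆q {k} k<1+t ¬pk qk with m<1+n⇒m<n∨m≡n k<1+t
... | inj₂ refl with p t | q t | count-mono t (⊆-upTo-pred p⊆q)
...   | true  | _     | _  = ⊥-elim (¬pk tt)
...   | false | true  | le = s≤s le
count-mono-< {p} {q} (suc t) p⊆q {k} k<1+t ¬pk qk | inj₁ k<t
  with p t | q t | p⊆q {t} ≤-refl | count-mono-< t (⊆-upTo-pred p⊆q) k<t ¬pk qk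
... | true  | true  | _      | ih = s≤s ih
... | true  | false | pt⇒qt | _  = ⊥-elim (pt⇒qt tt)
... | false | true  | _      | ih = m<n⇒m<1+n ih
... | false | false | _      | ih = ih

count< : ∀ p t {k} → k < t → ¬ T (p k) → count p t < t
count< p t k<t ¬pk = subst (count p t <_) (count-true t) (count-mono-< t (λ _ _ → tt) k<t ¬pk tt)

count-∨ : ∀ p q t → count (λ k → p k ∨ q k) t ≤ count p t + count q t
count-∨ p q zero = z≤n
count-∨ p q (suc t) with p t | q t | count-∨ p q t
... | true  | true  | ih = s≤s (≤-trans ih (+-monoʳ-≤ (count p t) (n≤1+n _)))
... | true  | false | ih = s≤s ih
... | false | true  | ih = ≤-trans (s≤s ih) (≤-reflexive (sym (+-suc (count p t) (count q t))))
... | false | false | ih = ih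

count-union : ∀ (q : ℕ → ℕ → Bool) {B} r p t → (∀ a → a < r → count (q a) t ≤ B) →
              (∀ {k} → k < t → T (p k) → ∃[ a ] a < r × T (q a k)) → count p t ≤ r * B
count-union q zero p t _ cover = begin
  count p t                ≤⟨ count-mono t (λ k<t pk → ⊥-elim (n≮0 (proj₁ (proj₂ (cover k<t pk))))) ⟩
  count (λ _ → false) t    ≡⟨ count-false t ⟩
  0                        ∎
  where open ≤-Reasoning
count-union q {B} (suc r) p t bound cover = begin
  count p t                        ≤⟨ count-mono t split ⟩
  count (λ k → q r k ∨ rest k) t   ≤⟨ count-∨ (q r) rest t ⟩
  count (q r) t + count rest t     ≤⟨ +-mono-≤ (bound r ≤-refl)
                                        (count-union q r rest t (λ a → bound a ∘ m<n⇒m<1+n) cover-rest) ⟩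
  B + r * B                        ∎
  where
  open ≤-Reasoning
  rest : ℕ → Bool
  rest k = p k ∧ not (q r k)
  split : p ⊆ (λ k → q r k ∨ rest k) upTo t
  split {k} _ pk with q r k
  ... | true  = tt
  ... | false = subst T (sym (∧-identityʳ (p k))) pk
  cover-rest : ∀ {k} → k < t → T (rest k) → ∃[ a ] a < r × T (q a k)
  cover-rest {k} k<t rk with Equivalence.to (T-∧ {p k}) rk
  ... | pk , ¬qrk with cover k<t pk
  ...   | a , a<1+r , qak with m<1+n⇒m<n∨m≡n a<1+r
  ...     | inj₁ a<r  = a , a<r , qak
  ...     | inj₂ refl = ⊥-elim (subst T (Equivalence.to T-not-≡ ¬qrk) qak)

≤2+2*count : ∀ b n → (∀ k → suc (suc k) < n → T (b k ∨ b (suc k))) → n ≤ 2 + 2 * count b (pred n)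
≤2+2*count b zero                _       = z≤n
≤2+2*count b (suc zero)          _       = s≤s z≤n
≤2+2*count b (suc (suc zero))    _       = s≤s (s≤s z≤n)
≤2+2*count b (suc (suc (suc n))) windows = begin
  2 + suc n                        ≤⟨ +-monoʳ-≤ 2 (≤2+2*count b (suc n)
                                        (λ k 2+k<1+n → windows k (m<n⇒m<1+n (m<n⇒m<1+n 2+k<1+n)))) ⟩
  2 + (2 + 2 * count b n)          ≡⟨ cong (2 +_) (sym (*-suc 2 (count b n))) ⟩
  2 + 2 * suc (count b n)          ≤⟨ +-monoʳ-≤ 2 (*-monoʳ-≤ 2 (two-steps (windows n ≤-refl))) ⟩
  2 + 2 * count b (suc (suc n))    ∎
  where
  open ≤-Reasoning
  two-steps : T (b n ∨ b (suc n)) → suc (count b n) ≤ count b (suc (suc n))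
  two-steps bn∨bn+1 with b n | b (suc n)
  ... | true  | true  = s≤s (n≤1+n _)
  ... | true  | false = ≤-refl
  ... | false | true  = ≤-refl

changes : (ℕ → ℕ) → ℕ → Bool
changes f k = not (f k ≡ᵇ f (suc k))

count-changes≤ : ∀ f t → (∀ {k} → k < t → f k ≤ f (suc k)) → count (changes f) t ≤ f t
count-changes≤ f zero    _    = z≤n
count-changes≤ f (suc t) mono with f t ≡ᵇ f (suc t) in eq
... | true  = ≤-trans (count-changes≤ f t (mono ∘ m<n⇒m<1+n)) (mono ≤-refl)
... | false = <-≤-trans (s≤s (count-changes≤ f t (mono ∘ m<n⇒m<1+n)))
                (≤∧≢⇒< (mono ≤-refl) (λ ft≡ → subst T eq (≡⇒≡ᵇ _ _ ft≡)))

¬changes⇒≡ : ∀ f {k} → ¬ T (changes f k) → f k ≡ f (suc k)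
¬changes⇒≡ f {k} unchanged with f k ≡ᵇ f (suc k) in eq
... | true  = ≡ᵇ⇒≡ _ _ (Equivalence.from T-≡ eq)
... | false = ⊥-elim (unchanged tt)

≡⇒¬changes : ∀ f {k} → f k ≡ f (suc k) → ¬ T (changes f k)
≡⇒¬changes f {k} fk≡ with f k ≡ᵇ f (suc k) in eq
... | true  = λ ()
... | false = λ _ → subst T eq (≡⇒≡ᵇ _ _ fk≡)

record Enumeration (p : ℕ → Bool) (t : ℕ) : Set where
  field
    pos       : ℕ → ℕ
    pos-true  : ∀ {s} → s < count p t → T (p (pos s))
    pos-<     : ∀ {s} → s < count p t → pos s < t
    count-pos : ∀ {s} → s < count p t → count p (pos s) ≡ s

  pos-strictMono : ∀ {s s′} → s < s′ → s′ < count p t → pos s < pos s′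
  pos-strictMono {s} {s′} s<s′ s′<c = ≰⇒> λ pos-s′≤pos-s → <⇒≱ s<s′ (begin
    s′                 ≡⟨ sym (count-pos s′<c) ⟩
    count p (pos s′)   ≤⟨ count-monoʳ p pos-s′≤pos-s ⟩
    count p (pos s)    ≡⟨ count-pos (<-trans s<s′ s′<c) ⟩
    s                  ∎)
    where open ≤-Reasoning

enumerate : ∀ p t → Enumeration p t
enumerate p zero = record { pos = λ _ → 0 ; pos-true = λ () ; pos-< = λ () ; count-pos = λ () }
enumerate p (suc t) with enumerate p t | p t in pt
... | E | false = record
  { pos       = pos
  ; pos-true  = pos-true ∘ old
  ; pos-<     = m<n⇒m<1+n ∘ pos-< ∘ old
  ; count-pos = count-pos ∘ old
  }
  where
  open Enumeration E
  old : ∀ {s} → s < count p (suc t) → s < count p t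
  old = subst (_ <_) (count-suc-false {p} pt)
... | E | true = record
  { pos       = pos′
  ; pos-true  = pos′-true ∘ new
  ; pos-<     = pos′-< ∘ new
  ; count-pos = count-pos′ ∘ new
  }
  where
  open Enumeration E
  new : ∀ {s} → s < count p (suc t) → s < suc (count p t)
  new = subst (_ <_) (count-suc-true {p} pt)
  pos′ : ℕ → ℕ
  pos′ s with s ≟ count p t
  ... | yes _ = t
  ... | no  _ = pos s
  pos′-true : ∀ {s} → s < suc (count p t) → T (p (pos′ s))
  pos′-true {s} s<1+c with s ≟ count p t
  ... | yes _  = Equivalence.from T-≡ pt
  ... | no s≢c = pos-true (≤∧≢⇒< (s≤s⁻¹ s<1+c) s≢c)
  pos′-< : ∀ {s} → s < suc (count p t) → pos′ s < suc t
  pos′-< {s} s<1+c with s ≟ count p t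
  ... | yes _  = ≤-refl
  ... | no s≢c = m<n⇒m<1+n (pos-< (≤∧≢⇒< (s≤s⁻¹ s<1+c) s≢c))
  count-pos′ : ∀ {s} → s < suc (count p t) → count p (pos′ s) ≡ s
  count-pos′ {s} s<1+c with s ≟ count p t
  ... | yes s≡c = sym s≡c
  ... | no s≢c  = count-pos (≤∧≢⇒< (s≤s⁻¹ s<1+c) s≢c)

¬T-∨ˡ : ∀ {x y} → ¬ T (x ∨ y) → ¬ T x
¬T-∨ˡ {true} ¬x∨y _ = ¬x∨y tt

¬T-∨ʳ : ∀ {x y} → ¬ T (x ∨ y) → ¬ T y
¬T-∨ʳ {true}  ¬x∨y _ = ¬x∨y tt
¬T-∨ʳ {false} ¬x∨y   = ¬x∨y

T-≡ᵇ∧<ᵇ : ∀ {x a y} → T ((x ≡ᵇ a) ∧ (a <ᵇ y)) ⇔ (x ≡ a × a < y)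
T-≡ᵇ∧<ᵇ {x} {a} {y} = mk⇔
  (λ t → let (x≡ᵇa , a<ᵇy) = Equivalence.to (T-∧ {x ≡ᵇ a}) t in ≡ᵇ⇒≡ x a x≡ᵇa , <ᵇ⇒< a y a<ᵇy)
  (λ (x≡a , a<y) → Equivalence.from (T-∧ {x ≡ᵇ a}) (≡⇒≡ᵇ x a x≡a , <⇒<ᵇ a<y))

m<pred[n]⇒suc[m]<n : ∀ {m n} → m < pred n → suc m < n
m<pred[n]⇒suc[m]<n {n = suc n} m<n = s≤s m<n

-- The last clause checks because suc (suc m) % 2 unfolds to m % 2.
parity-suc : ∀ m → (m % 2 ≡ 0 × suc m % 2 ≡ 1) ⊎ (m % 2 ≡ 1 × suc m % 2 ≡ 0)
parity-suc zero          = inj₁ (refl , refl)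
parity-suc (suc zero)    = inj₂ (refl , refl)
parity-suc (suc (suc m)) = parity-suc m

⌊i/2⌋<m : ∀ {i} m → i < m + m → ⌊ i /2⌋ < m
⌊i/2⌋<m {zero}        (suc m) _ = z<s
⌊i/2⌋<m {suc zero}    (suc m) _ = z<s
⌊i/2⌋<m {suc (suc i)} (suc m) 2+i<2+2m =
  s≤s (⌊i/2⌋<m m (s≤s⁻¹ (subst (suc (suc i) ≤_) (+-suc m m) (s≤s⁻¹ 2+i<2+2m))))

⌊/2⌋-cmp : ∀ {i j} → i < j → ⌊ i /2⌋ < ⌊ j /2⌋ ⊎ (⌊ i /2⌋ ≡ ⌊ j /2⌋ × i % 2 ≡ 0 × j % 2 ≡ 1)
⌊/2⌋-cmp {zero}        {suc zero}    _ = inj₂ (refl , refl , refl)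
⌊/2⌋-cmp {zero}        {suc (suc j)} _ = inj₁ z<s
⌊/2⌋-cmp {suc zero}    {suc (suc j)} _ = inj₁ z<s
⌊/2⌋-cmp {suc zero}    {suc zero}    (s≤s ())
⌊/2⌋-cmp {suc (suc i)} {suc (suc j)} (s≤s (s≤s i<j)) with ⌊/2⌋-cmp i<j
... | inj₁ lt             = inj₁ (s≤s lt)
... | inj₂ (eq , i₀ , j₁) = inj₂ (cong suc eq , i₀ , j₁)

-- Positions past the end read as the junk value 0.
extend : ∀ {n} → (Fin n → ℕ) → ℕ → ℕ
extend {n} f k with k <? n
... | yes k<n = f (fromℕ< k<n)
... | no  _   = 0

extend-fromℕ< : ∀ {n} (f : Fin n → ℕ) {k} (k<n : k < n) → extend f k ≡ f (fromℕ< k<n)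
extend-fromℕ< {n} f {k} k<n with k <? n
... | yes _  = refl
... | no k≮n = ⊥-elim (k≮n k<n)

extend-toℕ : ∀ {n} (f : Fin n → ℕ) i → extend f (toℕ i) ≡ f i
extend-toℕ f i = trans (extend-fromℕ< f (Fin.toℕ<n i)) (cong f (Fin.fromℕ<-toℕ i _))

extend-bound : ∀ {n c} (f : Fin n → ℕ) → (∀ i → f i ≤ c) → ∀ k → extend f k ≤ c
extend-bound {n} f f≤c k with k <? n
... | yes k<n = f≤c (fromℕ< k<n)
... | no  _   = z≤n

extend-toℕ-≡ : ∀ {n m} (g : Fin n → Fin m) {k l} (k<n : k < n) (l<n : l < n) →
               extend (toℕ ∘ g) k ≡ extend (toℕ ∘ g) l → g (fromℕ< k<n) ≡ g (fromℕ< l<n)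
extend-toℕ-≡ g k<n l<n eq =
  Fin.toℕ-injective (trans (sym (extend-fromℕ< (toℕ ∘ g) k<n)) (trans eq (extend-fromℕ< (toℕ ∘ g) l<n)))

value : ∀ {n} → Perm n → ℕ → ℕ
value π = extend (toℕ ∘ fun π)

value-injective : ∀ {n} (π : Perm n) {k l} → k < n → l < n → value π k ≡ value π l → k ≡ l
value-injective π {k} {l} k<n l<n vk≡vl = begin
  k                       ≡⟨ sym (Fin.toℕ-fromℕ< k<n) ⟩
  toℕ (fromℕ< k<n)        ≡⟨ cong toℕ (inj π (extend-toℕ-≡ (fun π) k<n l<n vk≡vl)) ⟩
  toℕ (fromℕ< l<n)        ≡⟨ Fin.toℕ-fromℕ< l<n ⟩
  l                       ∎
  where open ≡-Reasoning

Oriented : Bool → ℕ → ℕ → Set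
Oriented true  x y = x < y
Oriented false x y = y < x

Oriented-trans : ∀ b {x y z} → Oriented b x y → Oriented b y z → Oriented b x z
Oriented-trans true  x<y y<z = <-trans x<y y<z
Oriented-trans false y<x z<y = <-trans z<y y<x

<ᵇ-oriented : ∀ {x y} → x ≢ y → Oriented (x <ᵇ y) x y
<ᵇ-oriented {x} {y} x≢y with x <ᵇ y in x<ᵇy
... | true  = <ᵇ⇒< x y (Equivalence.from T-≡ x<ᵇy)
... | false = ≤∧≢⇒< (≮⇒≥ (λ x<y → subst T x<ᵇy (<⇒<ᵇ x<y))) (x≢y ∘ sym)

Oriented-alternating⇒¬monotone : ∀ b {x y z} → Oriented b x y → Oriented (not b) y z →
                                 ¬ ((x < y × y < z) ⊎ (z < y × y < x))
Oriented-alternating⇒¬monotone true  x<y z<y (inj₁ (_ , y<z)) = <-asym y<z z<y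
Oriented-alternating⇒¬monotone true  x<y z<y (inj₂ (_ , y<x)) = <-asym x<y y<x
Oriented-alternating⇒¬monotone false y<x y<z (inj₁ (x<y , _)) = <-asym x<y y<x
Oriented-alternating⇒¬monotone false y<x y<z (inj₂ (z<y , _)) = <-asym y<z z<y

Oriented⇒Fits : ∀ b {n} {x y : Fin n} → Oriented b (toℕ x) (toℕ y) → Fits (if b then inc else dec) x y
Oriented⇒Fits true  x<y = x<y
Oriented⇒Fits false y<x = y<x

Fits-monotone : ∀ {n} X {a b d : Fin n} → Fits X a b → Fits X b d →
                (a Fin.< b × b Fin.< d) ⊎ (d Fin.< b × b Fin.< a)
Fits-monotone inc a<b b<d = inj₁ (a<b , b<d)
Fits-monotone dec b<a d<b = inj₂ (d<b , b<a)

-- Patterns at selected positions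

module Restriction {n k} (π : Perm n) (K : ℕ → ℕ)
  (K-< : ∀ {s} → s < k → K s < n)
  (K-mono : ∀ {s s′} → s < s′ → s′ < k → K s < K s′) where

  selected : ℕ → ℕ
  selected s = value π (K s)

  private
    selected-injective : ∀ {a b} → a < k → b < k → selected a ≡ selected b → a ≡ b
    selected-injective {a} {b} a<k b<k va≡vb with <-cmp a b
    ... | tri< a<b _ _ = ⊥-elim (<-irrefl (value-injective π (K-< a<k) (K-< b<k) va≡vb) (K-mono a<b b<k))
    ... | tri≈ _ a≡b _ = a≡b
    ... | tri> _ _ b<a = ⊥-elim (<-irrefl (value-injective π (K-< b<k) (K-< a<k) (sym va≡vb)) (K-mono b<a a<k))

    rank : ℕ → ℕ
    rank s = count (λ j → selected j <ᵇ selected s) k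

    rank-< : ∀ {s} → s < k → rank s < k
    rank-< {s} s<k = count< _ k s<k (<-irrefl refl ∘ <ᵇ⇒< (selected s) (selected s))

    rank-mono : ∀ {a b} → a < k → selected a < selected b → rank a < rank b
    rank-mono {a} {b} a<k va<vb = count-mono-< k
      (λ {j} _ vj<va → <⇒<ᵇ (<-trans (<ᵇ⇒< (selected j) (selected a) vj<va) va<vb))
      a<k (<-irrefl refl ∘ <ᵇ⇒< (selected a) (selected a)) (<⇒<ᵇ va<vb)

    rank-reflects : ∀ {a b} → a < k → b < k → rank a < rank b → selected a < selected b
    rank-reflects {a} {b} a<k b<k ra<rb with <-cmp (selected a) (selected b)
    ... | tri< va<vb _ _ = va<vb
    ... | tri≈ _ va≡vb _ = ⊥-elim (<-irrefl (cong rank (selected-injective a<k b<k va≡vb)) ra<rb)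
    ... | tri> _ _ vb<va = ⊥-elim (<-asym ra<rb (rank-mono b<k vb<va))

    std : Fin k → Fin k
    std i = fromℕ< (rank-< (Fin.toℕ<n i))

    toℕ-std : ∀ i → toℕ (std i) ≡ rank (toℕ i)
    toℕ-std i = Fin.toℕ-fromℕ< _

  restrict : Perm k
  restrict = perm std std-injective
    where
    std-injective : ∀ {a b} → std a ≡ std b → a ≡ b
    std-injective {a} {b} sa≡sb with <-cmp (selected (toℕ a)) (selected (toℕ b))
    ... | tri≈ _ va≡vb _ = Fin.toℕ-injective (selected-injective (Fin.toℕ<n a) (Fin.toℕ<n b) va≡vb)
    ... | tri< va<vb _ _ = ⊥-elim (<-irrefl ra≡rb (rank-mono (Fin.toℕ<n a) va<vb))
      where ra≡rb = trans (sym (toℕ-std a)) (trans (cong toℕ sa≡sb) (toℕ-std b))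
    ... | tri> _ _ vb<va = ⊥-elim (<-irrefl (sym ra≡rb) (rank-mono (Fin.toℕ<n b) vb<va))
      where ra≡rb = trans (sym (toℕ-std a)) (trans (cong toℕ sa≡sb) (toℕ-std b))

  restrict-< : ∀ a b → fun restrict a Fin.< fun restrict b ⇔ selected (toℕ a) < selected (toℕ b)
  restrict-< a b = mk⇔
    (rank-reflects (Fin.toℕ<n a) (Fin.toℕ<n b) ∘ subst₂ _<_ (toℕ-std a) (toℕ-std b))
    (subst₂ _<_ (sym (toℕ-std a)) (sym (toℕ-std b)) ∘ rank-mono (Fin.toℕ<n a))

  restrict-≼ : restrict ≼ π
  restrict-≼ = position , position-mono , λ i j →
    subst₂ _<_ (value-position i) (value-position j) ∘ Equivalence.to (restrict-< i j) ,
    Equivalence.from (restrict-< i j) ∘ subst₂ _<_ (sym (value-position i)) (sym (value-position j))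
    where
    position : Fin k → Fin n
    position i = fromℕ< (K-< (Fin.toℕ<n i))
    position-mono : ∀ i j → i Fin.< j → position i Fin.< position j
    position-mono i j i<j =
      subst₂ _<_ (sym (Fin.toℕ-fromℕ< _)) (sym (Fin.toℕ-fromℕ< _)) (K-mono i<j (Fin.toℕ<n j))
    value-position : ∀ i → value π (K (toℕ i)) ≡ toℕ (fun π (position i))
    value-position i = extend-fromℕ< (toℕ ∘ fun π) (K-< (Fin.toℕ<n i))

  restrict-zigzag : (∀ s → suc (suc s) < k → ∃[ b ] Oriented b (selected s) (selected (suc s))
                                                × Oriented (not b) (selected (suc s)) (selected (suc (suc s)))) →
                    Zigzag restrict
  restrict-zigzag alternates i j l j≡1+i l≡1+j
    with alternates (toℕ i) (subst (_< k) (trans l≡1+j (cong suc j≡1+i)) (Fin.toℕ<n l))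
  ... | b , i→j , j→l = Oriented-alternating⇒¬monotone b
          (subst (λ x → Oriented b (selected (toℕ i)) (selected x)) (sym j≡1+i) i→j)
          (subst₂ (λ x y → Oriented (not b) (selected x) (selected y))
                  (sym j≡1+i) (sym (trans l≡1+j (cong suc j≡1+i))) j→l)
        ∘ Sum.map (Product.map (to i j) (to j l)) (Product.map (to l j) (to j i))
    where
    to : ∀ a b → fun restrict a Fin.< fun restrict b → selected (toℕ a) < selected (toℕ b)
    to a b = Equivalence.to (restrict-< a b)

module PairAlternation {n} (π : Perm n) (p : ℕ → Bool) (p-sparse : ∀ {k} → T (p k) → ¬ T (p (suc k))) where

  open Enumeration (enumerate p (pred n)) public renaming (pos to pairPos)

  pairs : ℕ
  pairs = count p (pred n)

  pairPos-gap : ∀ {s s′} → s < s′ → s′ < pairs → suc (pairPos s) < pairPos s′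
  pairPos-gap {s} {s′} s<s′ s′<pairs with suc (pairPos s) ≟ pairPos s′
  ... | no  1+pairPos≢ = ≤∧≢⇒< (pos-strictMono s<s′ s′<pairs) 1+pairPos≢
  ... | yes 1+pairPos≡ = ⊥-elim (p-sparse (pos-true (<-trans s<s′ s′<pairs))
                                         (subst (T ∘ p) (sym 1+pairPos≡) (pos-true s′<pairs)))

  entry : ℕ → ℕ
  entry i = pairPos ⌊ i /2⌋ + i % 2

  entry-≤ : ∀ i → entry i ≤ suc (pairPos ⌊ i /2⌋)
  entry-≤ i = ≤-trans (+-monoʳ-≤ (pairPos ⌊ i /2⌋) (s≤s⁻¹ (m%n<n i 2))) (≤-reflexive (+-comm _ 1))

  entry-< : ∀ {i} → i < pairs + pairs → entry i < n
  entry-< {i} i<2pairs = ≤-<-trans (entry-≤ i) (m<pred[n]⇒suc[m]<n (pos-< (⌊i/2⌋<m pairs i<2pairs)))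

  entry-mono : ∀ {i j} → i < j → j < pairs + pairs → entry i < entry j
  entry-mono {i} {j} i<j j<2pairs with ⌊/2⌋-cmp i<j
  ... | inj₁ lt = begin-strict
    entry i                 ≤⟨ entry-≤ i ⟩
    suc (pairPos ⌊ i /2⌋)   <⟨ pairPos-gap lt (⌊i/2⌋<m pairs j<2pairs) ⟩
    pairPos ⌊ j /2⌋         ≤⟨ m≤m+n _ _ ⟩
    entry j                 ∎
    where open ≤-Reasoning
  ... | inj₂ (same-pair , i₀ , j₁) = begin-strict
    pairPos ⌊ i /2⌋ + i % 2   ≡⟨ cong (pairPos ⌊ i /2⌋ +_) i₀ ⟩
    pairPos ⌊ i /2⌋ + 0       <⟨ +-monoʳ-< (pairPos ⌊ i /2⌋) z<s ⟩
    pairPos ⌊ i /2⌋ + 1       ≡⟨ cong₂ _+_ (cong pairPos same-pair) (sym j₁) ⟩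
    pairPos ⌊ j /2⌋ + j % 2   ∎
    where open ≤-Reasoning

  open Restriction π entry entry-< entry-mono

  alternation : Perm (pairs + pairs)
  alternation = restrict

  alternation-≼ : alternation ≼ π
  alternation-≼ = restrict-≼

  private
    entry-odd : ∀ {i : Fin (pairs + pairs)} → OddIdx i → entry (toℕ i) ≡ pairPos ⌊ toℕ i /2⌋
    entry-odd {i} i₀ = trans (cong (pairPos ⌊ toℕ i /2⌋ +_) i₀) (+-identityʳ _)

    entry-even : ∀ {j : Fin (pairs + pairs)} → EvenIdx j → entry (toℕ j) ≡ suc (pairPos ⌊ toℕ j /2⌋)
    entry-even {j} j₁ = trans (cong (pairPos ⌊ toℕ j /2⌋ +_) j₁) (+-comm _ 1)

    pair-< : ∀ (i : Fin (pairs + pairs)) → ⌊ toℕ i /2⌋ < pairs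
    pair-< i = ⌊i/2⌋<m pairs (Fin.toℕ<n i)

  seconds<firsts⇒alternation :
    (∀ {s s′} → s < pairs → s′ < pairs → value π (suc (pairPos s)) < value π (pairPos s′)) →
    VerticalAlternation alternation
  seconds<firsts⇒alternation second<first = inj₁ λ i j i₀ j₁ → Equivalence.from (restrict-< j i)
    (subst₂ (λ x y → value π x < value π y) (sym (entry-even j₁)) (sym (entry-odd i₀))
      (second<first (pair-< j) (pair-< i)))

  firsts<seconds⇒alternation :
    (∀ {s s′} → s < pairs → s′ < pairs → value π (pairPos s) < value π (suc (pairPos s′))) →
    VerticalAlternation alternation
  firsts<seconds⇒alternation first<second = inj₂ λ i j i₀ j₁ → Equivalence.from (restrict-< i j)
    (subst₂ (λ x y → value π x < value π y) (sym (entry-odd i₀)) (sym (entry-even j₁))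
      (first<second (pair-< i) (pair-< j)))

Valley Peak : ∀ {n} → Perm n → (i j k : Fin n) → Set
Valley π i j k = fun π j Fin.< fun π i × fun π j Fin.< fun π k
Peak   π i j k = fun π i Fin.< fun π j × fun π k Fin.< fun π j

alternation-extremal : ∀ {n} (π : Perm n) → VerticalAlternation π →
  ∀ i j k → toℕ j ≡ suc (toℕ i) → toℕ k ≡ suc (toℕ j) → Valley π i j k ⊎ Peak π i j k
alternation-extremal π va i j k j≡1+i k≡1+j = extremal (parity-suc (toℕ i)) va
  where
  j-parity : ∀ {b} → suc (toℕ i) % 2 ≡ b → toℕ j % 2 ≡ b
  j-parity = trans (cong (_% 2) j≡1+i)
  k-parity : ∀ {b} → toℕ i % 2 ≡ b → toℕ k % 2 ≡ b
  k-parity = trans (cong (_% 2) (trans k≡1+j (cong suc j≡1+i)))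
  extremal : (toℕ i % 2 ≡ 0 × suc (toℕ i) % 2 ≡ 1) ⊎ (toℕ i % 2 ≡ 1 × suc (toℕ i) % 2 ≡ 0) →
             VerticalAlternation π → Valley π i j k ⊎ Peak π i j k
  extremal (inj₁ (i₀ , j₁)) (inj₁ odd>even) =
    inj₁ (odd>even i j i₀ (j-parity j₁) , odd>even k j (k-parity i₀) (j-parity j₁))
  extremal (inj₁ (i₀ , j₁)) (inj₂ odd<even) =
    inj₂ (odd<even i j i₀ (j-parity j₁) , odd<even k j (k-parity i₀) (j-parity j₁))
  extremal (inj₂ (i₁ , j₀)) (inj₁ odd>even) =
    inj₂ (odd>even j i (j-parity j₀) i₁ , odd>even j k (j-parity j₀) (k-parity i₁))
  extremal (inj₂ (i₁ , j₀)) (inj₂ odd<even) =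
    inj₁ (odd<even j i (j-parity j₀) i₁ , odd<even j k (j-parity j₀) (k-parity i₁))

alternation⇒zigzag : ∀ {n} (π : Perm n) → VerticalAlternation π → Zigzag π
alternation⇒zigzag π va i j k j≡1+i k≡1+j monotone
  with alternation-extremal π va i j k j≡1+i k≡1+j | monotone
... | inj₁ (j<i , _)   | inj₁ (i<j , _)   = <-asym i<j j<i
... | inj₁ (_ , j<k)   | inj₂ (k<j , _)   = <-asym j<k k<j
... | inj₂ (_ , k<j)   | inj₁ (_ , j<k)   = <-asym j<k k<j
... | inj₂ (i<j , _)   | inj₂ (_ , j<i)   = <-asym j<i i<j

ContainsAlternation : ∀ {n} → Perm n → ℕ → Set
ContainsAlternation π m = Σ (Perm m) λ σ → σ ≼ π × VerticalAlternation σ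

-- Finitely many permutations versus bounded length

BoundedLength : PermSet → Set
BoundedLength P = Σ ℕ λ B → ∀ {n} (π : Perm n) → P π → n ≤ B

length-oneLine : ∀ {n} (π : Perm n) → length (oneLine π) ≡ n
length-oneLine {n} π = trans (length-map _ (allFin n)) (length-tabulate (λ i → i))

∈-oneLine⇒< : ∀ {n} (π : Perm n) {x} → x ∈ oneLine π → x < n
∈-oneLine⇒< π x∈ with ∈-map⁻ (toℕ ∘ fun π) x∈
... | _ , _ , refl = Fin.toℕ<n _

maxLength : List (List ℕ) → ℕ
maxLength = foldr (λ xs m → length xs ⊔ m) 0

length≤maxLength : ∀ {xs} L → xs ∈ L → length xs ≤ maxLength L
length≤maxLength (ys ∷ L) (here refl) = m≤m⊔n _ _
length≤maxLength (ys ∷ L) (there xs∈L) = ≤-trans (length≤maxLength L xs∈L) (m≤n⊔m _ _)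

finitelyMany⇒boundedLength : (P : PermSet) → FinitelyMany P → BoundedLength P
finitelyMany⇒boundedLength P (L , complete) =
  maxLength L , λ π Pπ → subst (_≤ maxLength L) (length-oneLine π) (length≤maxLength L (complete π Pπ))

lists : ℕ → ℕ → List (List ℕ)
lists b zero    = [] ∷ []
lists b (suc l) = cartesianProductWith _∷_ (upTo b) (lists b l)

∈-lists : ∀ b xs → (∀ {x} → x ∈ xs → x < b) → xs ∈ lists b (length xs)
∈-lists b []       _     = here refl
∈-lists b (x ∷ xs) all<b =
  ∈-cartesianProductWith⁺ _∷_ (∈-upTo⁺ (all<b (here refl))) (∈-lists b xs (all<b ∘ there))

boundedLength⇒finitelyMany : (P : PermSet) → BoundedLength P → FinitelyMany P
boundedLength⇒finitelyMany P (B , bounded) = concatMap (lists B) (upTo (suc B)) , λ π Pπ →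
  ∈-concatMap⁺ (lists B) (lose (∈-upTo⁺ (s≤s (subst (_≤ B) (sym (length-oneLine π)) (bounded π Pπ))))
    (∈-lists B (oneLine π) (λ x∈ → <-≤-trans (∈-oneLine⇒< π x∈) (bounded π Pπ))))

-- Boundedly long zigzags: monotone runs

rising : ℕ → Bool
rising zero    = true
rising (suc s) = not (rising s)

alternatingRow : (c : ℕ) → Matrix c 1
alternatingRow c x _ = if rising (toℕ x) then inc else dec

module MonotoneRuns {n} (π : Perm n) where

  ascent : ℕ → Bool
  ascent k = value π k <ᵇ value π (suc k)

  ascent-oriented : ∀ {k} → suc k < n → Oriented (ascent k) (value π k) (value π (suc k))
  ascent-oriented {k} 1+k<n =
    <ᵇ-oriented (λ vk≡vk+1 → <-irrefl (value-injective π (<-trans (n<1+n k) 1+k<n) 1+k<n vk≡vk+1) (n<1+n k))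

  -- A turn at k: the step from k to k + 1 goes against the direction of the
  -- current column, and so opens the next one.
  mutual
    column : ℕ → ℕ
    column zero    = 0
    column (suc k) = if turn k then suc (column k) else column k

    turn : ℕ → Bool
    turn k = ascent k xor rising (column k)

  column≡count-turn : ∀ k → column k ≡ count turn k
  column≡count-turn zero    = refl
  column≡count-turn (suc k) with turn k
  ... | true  = cong suc (column≡count-turn k)
  ... | false = column≡count-turn k

  column-monoʳ : ∀ {k l} → k ≤ l → column k ≤ column l
  column-monoʳ {k} {l} k≤l =
    subst₂ _≤_ (sym (column≡count-turn k)) (sym (column≡count-turn l)) (count-monoʳ turn k≤l)

  ascent≡rising-column : ∀ k → ascent k ≡ rising (column (suc k))
  ascent≡rising-column k with ascent k | rising (column k) in r
  ... | true  | true  = sym r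
  ... | true  | false = sym (cong not r)
  ... | false | true  = sym (cong not r)
  ... | false | false = sym r

  step-oriented : ∀ {k} → suc k < n → Oriented (rising (column (suc k))) (value π k) (value π (suc k))
  step-oriented {k} 1+k<n =
    subst (λ b → Oriented b (value π k) (value π (suc k))) (ascent≡rising-column k) (ascent-oriented 1+k<n)

  column-run : ∀ {a b} → a < b → b < n → column (suc a) ≡ column b →
               Oriented (rising (column b)) (value π a) (value π b)
  column-run {a} {suc b} a<1+b 1+b<n col-eq with m<1+n⇒m<n∨m≡n a<1+b
  ... | inj₂ refl = step-oriented 1+b<n
  ... | inj₁ a<b  = Oriented-trans (rising (column (suc b)))
        (subst (λ c → Oriented (rising c) (value π a) (value π b)) same-column
          (column-run a<b (<-trans (n<1+n b) 1+b<n)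
            (≤-antisym (column-monoʳ a<b) (≤-trans (column-monoʳ (n≤1+n b)) (≤-reflexive (sym col-eq))))))
        (step-oriented 1+b<n)
    where
    same-column : column b ≡ column (suc b)
    same-column = ≤-antisym (column-monoʳ (n≤1+n b))
                    (≤-trans (≤-reflexive (sym col-eq)) (column-monoʳ a<b))

  open Enumeration (enumerate turn (pred n)) renaming (pos to turning)

  turns : ℕ
  turns = count turn (pred n)

  column-turning : ∀ {s} → s < turns → column (turning s) ≡ s
  column-turning {s} s<turns = trans (column≡count-turn (turning s)) (count-pos s<turns)

  column-after-turning : ∀ {s} → s < turns → column (suc (turning s)) ≡ suc s
  column-after-turning {s} s<turns with turn (turning s) | pos-true s<turns
  ... | true | _ = cong suc (column-turning s<turns)

  turning-< : ∀ {s} → s < turns → turning s < n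
  turning-< s<turns = <-≤-trans (pos-< s<turns) pred[n]≤n

  turning-oriented : ∀ {s} → suc s < turns →
                     Oriented (rising (suc s)) (value π (turning s)) (value π (turning (suc s)))
  turning-oriented {s} 1+s<turns =
    subst (λ c → Oriented (rising c) (value π (turning s)) (value π (turning (suc s))))
      (column-turning 1+s<turns)
      (column-run (pos-strictMono (n<1+n s) 1+s<turns) (turning-< 1+s<turns)
        (trans (column-after-turning (<-trans (n<1+n s) 1+s<turns)) (sym (column-turning 1+s<turns))))

  open Restriction π turning turning-< pos-strictMono

  turningPoints : Perm turns
  turningPoints = restrict

  turningPoints-≼ : turningPoints ≼ π
  turningPoints-≼ = restrict-≼

  turningPoints-zigzag : Zigzag turningPoints
  turningPoints-zigzag = restrict-zigzag λ s 2+s<turns →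
    rising (suc s) , turning-oriented (<-trans (n<1+n (suc s)) 2+s<turns) , turning-oriented 2+s<turns

  inAlternatingGrid : ∀ B → turns ≤ B → InGrid (alternatingRow (suc B)) π
  inAlternatingGrid B turns≤B = col , (λ _ → Fin.zero) , col-mono , (λ _ _ _ → z≤n) , nonEmpty , fits
    where
    column≤B : ∀ i → column (toℕ i) ≤ B
    column≤B i = begin
      column (toℕ i)   ≤⟨ column-monoʳ (<⇒≤pred (Fin.toℕ<n i)) ⟩
      column (pred n)  ≡⟨ column≡count-turn (pred n) ⟩
      turns            ≤⟨ turns≤B ⟩
      B                ∎
      where open ≤-Reasoning
    col : Fin n → Fin (suc B)
    col i = fromℕ< (s≤s (column≤B i))
    toℕ-col : ∀ i → toℕ (col i) ≡ column (toℕ i)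
    toℕ-col i = Fin.toℕ-fromℕ< _
    col-mono : ∀ i j → i Fin.≤ j → col i Fin.≤ col j
    col-mono i j i≤j = subst₂ _≤_ (sym (toℕ-col i)) (sym (toℕ-col j)) (column-monoʳ i≤j)
    nonEmpty : ∀ i → alternatingRow (suc B) (col i) Fin.zero ≢ empty
    nonEmpty i with rising (toℕ (col i))
    ... | true  = λ ()
    ... | false = λ ()
    fits : ∀ i j → i Fin.< j → col i ≡ col j → Fin.zero ≡ Fin.zero →
           Fits (alternatingRow (suc B) (col i) Fin.zero) (fun π i) (fun π j)
    fits i j i<j col-eq _ = Oriented⇒Fits (rising (toℕ (col i)))
      (subst₂ (Oriented (rising (toℕ (col i)))) (extend-toℕ (toℕ ∘ fun π) i) (extend-toℕ (toℕ ∘ fun π) j) run)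
      where
      same-column : toℕ (col i) ≡ column (toℕ j)
      same-column = trans (cong toℕ col-eq) (toℕ-col j)
      no-turn-between : column (suc (toℕ i)) ≡ column (toℕ j)
      no-turn-between = ≤-antisym (column-monoʳ i<j) (begin
        column (toℕ j)        ≡⟨ sym same-column ⟩
        toℕ (col i)           ≡⟨ toℕ-col i ⟩
        column (toℕ i)        ≤⟨ column-monoʳ (n≤1+n (toℕ i)) ⟩
        column (suc (toℕ i))  ∎)
        where open ≤-Reasoning
      run : Oriented (rising (toℕ (col i))) (value π (toℕ i)) (value π (toℕ j))
      run = subst (λ c → Oriented (rising c) (value π (toℕ i)) (value π (toℕ j))) (sym same-column)
              (column-run i<j (Fin.toℕ<n j) no-turn-between)

boundedZigzags⇒monotoneGriddable : (C : PermSet) → IsClass C → BoundedLength (C ∩Zigzag) → MonotoneGriddable C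
boundedZigzags⇒monotoneGriddable C isClass (B , bounded) = suc B , 1 , alternatingRow (suc B) , λ π Cπ →
  let open MonotoneRuns π in
  inAlternatingGrid B (bounded turningPoints (isClass turningPoints π turningPoints-≼ Cπ , turningPoints-zigzag))

boundedZigzags⇒boundedAlternations : (C : PermSet) → BoundedLength (C ∩Zigzag) → BoundedVerticalAlternations C
boundedZigzags⇒boundedAlternations C (B , bounded) =
  B , λ π Cπ va → bounded π (Cπ , alternation⇒zigzag π va)

-- Zigzags in a monotone grid class

module GriddedZigzag {c r} (M : Matrix c r) {n} (π : Perm n) (π-zigzag : Zigzag π)
  (col : Fin n → Fin c) (row : Fin n → Fin r)
  (col-mono : ∀ i j → i Fin.≤ j → col i Fin.≤ col j)
  (row-mono : ∀ v w → v Fin.≤ w → row v Fin.≤ row w)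
  (fits : ∀ i j → i Fin.< j → col i ≡ col j → row (fun π i) ≡ row (fun π j) →
          Fits (M (col i) (row (fun π i))) (fun π i) (fun π j)) where

  colAt rowAt : ℕ → ℕ
  colAt = extend (toℕ ∘ col)
  rowAt = extend (toℕ ∘ row ∘ fun π)

  break : ℕ → Bool
  break k = changes colAt k ∨ changes rowAt k

  rowAt-<⇒value-< : ∀ {k l} → k < n → l < n → rowAt k < rowAt l → value π k < value π l
  rowAt-<⇒value-< {k} {l} k<n l<n rk<rl = ≰⇒> λ vl≤vk → <⇒≱ rk<rl
    (subst₂ _≤_ (sym (rowAt-at l<n)) (sym (rowAt-at k<n))
      (row-mono _ _ (subst₂ _≤_ (value-at l<n) (value-at k<n) vl≤vk)))
    where
    rowAt-at = extend-fromℕ< (toℕ ∘ row ∘ fun π)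
    value-at = extend-fromℕ< (toℕ ∘ fun π)

  break-in-window : ∀ k → suc (suc k) < n → T (break k ∨ break (suc k))
  break-in-window k 2+k<n with T? (break k ∨ break (suc k))
  ... | yes some-break = some-break
  ... | no  no-break   = ⊥-elim (π-zigzag i j l (toℕ-at-suc p₀ p₁) (toℕ-at-suc p₁ p₂)
          (Fits-monotone (M (col i) (row (fun π i))) (fits i j (at-< p₀ p₁) col-ij row-ij)
            (subst (λ X → Fits X (fun π j) (fun π l)) (sym (cong₂ M col-ij row-ij))
              (fits j l (at-< p₁ p₂) col-jl row-jl))))
    where
    p₂ = 2+k<n
    p₁ = <-trans (n<1+n (suc k)) p₂
    p₀ = <-trans (n<1+n k) p₁
    i = fromℕ< p₀
    j = fromℕ< p₁
    l = fromℕ< p₂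
    toℕ-at-suc : ∀ {m} (m<n : m < n) (1+m<n : suc m < n) →
                 toℕ (fromℕ< 1+m<n) ≡ suc (toℕ (fromℕ< m<n))
    toℕ-at-suc m<n 1+m<n = trans (Fin.toℕ-fromℕ< 1+m<n) (cong suc (sym (Fin.toℕ-fromℕ< m<n)))
    at-< : ∀ {m} (m<n : m < n) (1+m<n : suc m < n) → fromℕ< m<n Fin.< fromℕ< 1+m<n
    at-< m<n 1+m<n = subst (toℕ (fromℕ< m<n) <_) (sym (toℕ-at-suc m<n 1+m<n)) ≤-refl
    unbroken : ∀ {m} → ¬ T (break m) → colAt m ≡ colAt (suc m) × rowAt m ≡ rowAt (suc m)
    unbroken ¬bm = ¬changes⇒≡ colAt (¬T-∨ˡ ¬bm) , ¬changes⇒≡ rowAt (¬T-∨ʳ {changes colAt _} ¬bm)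
    unbroken-k   = unbroken (¬T-∨ˡ no-break)
    unbroken-1+k = unbroken (¬T-∨ʳ {break k} no-break)
    col-ij = extend-toℕ-≡ col p₀ p₁ (proj₁ unbroken-k)
    row-ij = extend-toℕ-≡ (row ∘ fun π) p₀ p₁ (proj₂ unbroken-k)
    col-jl = extend-toℕ-≡ col p₁ p₂ (proj₁ unbroken-1+k)
    row-jl = extend-toℕ-≡ (row ∘ fun π) p₁ p₂ (proj₂ unbroken-1+k)

  colChanges≤ : count (changes colAt) (pred n) ≤ c
  colChanges≤ = ≤-trans (count-changes≤ colAt (pred n) colAt-mono)
                        (extend-bound (toℕ ∘ col) (λ i → <⇒≤ (Fin.toℕ<n (col i))) (pred n))
    where
    colAt-mono : ∀ {k} → k < pred n → colAt k ≤ colAt (suc k)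
    colAt-mono {k} k<pred[n] =
      subst₂ _≤_ (sym (extend-fromℕ< (toℕ ∘ col) k<n)) (sym (extend-fromℕ< (toℕ ∘ col) 1+k<n))
        (col-mono _ _ (subst₂ _≤_ (sym (Fin.toℕ-fromℕ< k<n)) (sym (Fin.toℕ-fromℕ< 1+k<n)) (n≤1+n k)))
      where
      1+k<n = m<pred[n]⇒suc[m]<n k<pred[n]
      k<n   = <-trans (n<1+n k) 1+k<n

  rowAt-< : ∀ {k} → k < n → rowAt k < r
  rowAt-< k<n = subst (_< r) (sym (extend-fromℕ< (toℕ ∘ row ∘ fun π) k<n)) (Fin.toℕ<n _)

  descentInto ascentFrom : ℕ → ℕ → Bool
  descentInto a k = (rowAt (suc k) ≡ᵇ a) ∧ (a <ᵇ rowAt k)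
  ascentFrom  a k = (rowAt k ≡ᵇ a) ∧ (a <ᵇ rowAt (suc k))

  T-descentInto : ∀ {a k} → T (descentInto a k) ⇔ (rowAt (suc k) ≡ a × a < rowAt k)
  T-descentInto {a} {k} = T-≡ᵇ∧<ᵇ {rowAt (suc k)}

  T-ascentFrom : ∀ {a k} → T (ascentFrom a k) ⇔ (rowAt k ≡ a × a < rowAt (suc k))
  T-ascentFrom {a} {k} = T-≡ᵇ∧<ᵇ {rowAt k}

  rowChange⇒descent-or-ascent : ∀ {k} → k < pred n → T (changes rowAt k) →
                                ∃[ a ] a < r × T (descentInto a k ∨ ascentFrom a k)
  rowChange⇒descent-or-ascent {k} k<pred[n] changed with <-cmp (rowAt k) (rowAt (suc k))
  ... | tri< up _ _ = rowAt k , rowAt-< (<-trans (n<1+n k) 1+k<n) ,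
        Equivalence.from (T-∨ {descentInto (rowAt k) k})
          (inj₂ (Equivalence.from T-ascentFrom (refl , up)))
    where 1+k<n = m<pred[n]⇒suc[m]<n k<pred[n]
  ... | tri≈ _ same _ = ⊥-elim (≡⇒¬changes rowAt same changed)
  ... | tri> _ _ down = rowAt (suc k) , rowAt-< (m<pred[n]⇒suc[m]<n k<pred[n]) ,
        Equivalence.from (T-∨ {descentInto (rowAt (suc k)) k})
          (inj₁ (Equivalence.from T-descentInto (refl , down)))

  descentInto-sparse : ∀ {a k} → T (descentInto a k) → ¬ T (descentInto a (suc k))
  descentInto-sparse d₀ d₁ =
    <-irrefl (sym (proj₁ (Equivalence.to T-descentInto d₀))) (proj₂ (Equivalence.to T-descentInto d₁))

  ascentFrom-sparse : ∀ {a k} → T (ascentFrom a k) → ¬ T (ascentFrom a (suc k))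
  ascentFrom-sparse d₀ d₁ =
    <-irrefl (sym (proj₁ (Equivalence.to T-ascentFrom d₁))) (proj₂ (Equivalence.to T-ascentFrom d₀))

  descents-alternation : ∀ a →
    ContainsAlternation π (count (descentInto a) (pred n) + count (descentInto a) (pred n))
  descents-alternation a = alternation , alternation-≼ , seconds<firsts⇒alternation λ s<pairs s′<pairs →
    let (into , _) = Equivalence.to T-descentInto (pos-true s<pairs)
        (_ , below) = Equivalence.to T-descentInto (pos-true s′<pairs) in
    rowAt-<⇒value-< (m<pred[n]⇒suc[m]<n (pos-< s<pairs)) (<-≤-trans (pos-< s′<pairs) pred[n]≤n)
      (subst (_< rowAt _) (sym into) below)
    where open PairAlternation π (descentInto a) descentInto-sparse

  ascents-alternation : ∀ a →
    ContainsAlternation π (count (ascentFrom a) (pred n) + count (ascentFrom a) (pred n))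
  ascents-alternation a = alternation , alternation-≼ , firsts<seconds⇒alternation λ s<pairs s′<pairs →
    let (from , _) = Equivalence.to T-ascentFrom (pos-true s<pairs)
        (_ , above) = Equivalence.to T-ascentFrom (pos-true s′<pairs) in
    rowAt-<⇒value-< (<-≤-trans (pos-< s<pairs) pred[n]≤n) (m<pred[n]⇒suc[m]<n (pos-< s′<pairs))
      (subst (_< rowAt _) (sym from) above)
    where open PairAlternation π (ascentFrom a) ascentFrom-sparse

  length-bound : ∀ N → (∀ {m} → ContainsAlternation π (m + m) → m ≤ N) → n ≤ 2 + 2 * (c + r * (N + N))
  length-bound N alternation≤ = begin
    n                             ≤⟨ ≤2+2*count break n break-in-window ⟩
    2 + 2 * count break (pred n)  ≤⟨ +-monoʳ-≤ 2 (*-monoʳ-≤ 2 breaks≤) ⟩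
    2 + 2 * (c + r * (N + N))     ∎
    where
    open ≤-Reasoning
    rowChanges≤ : count (changes rowAt) (pred n) ≤ r * (N + N)
    rowChanges≤ = count-union (λ a k → descentInto a k ∨ ascentFrom a k) r (changes rowAt) (pred n)
      (λ a _ → ≤-trans (count-∨ (descentInto a) (ascentFrom a) (pred n))
                 (+-mono-≤ (alternation≤ {count (descentInto a) (pred n)} (descents-alternation a))
                           (alternation≤ {count (ascentFrom a) (pred n)} (ascents-alternation a))))
      rowChange⇒descent-or-ascent
    breaks≤ : count break (pred n) ≤ c + r * (N + N)
    breaks≤ = ≤-trans (count-∨ (changes colAt) (changes rowAt) (pred n)) (+-mono-≤ colChanges≤ rowChanges≤)

griddable×boundedAlternations⇒boundedZigzags : (C : PermSet) → IsClass C →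
  MonotoneGriddable C → BoundedVerticalAlternations C → BoundedLength (C ∩Zigzag)
griddable×boundedAlternations⇒boundedZigzags C isClass (c , r , M , gridded) (N , bounded) =
  2 + 2 * (c + r * (N + N)) , λ π (Cπ , π-zigzag) →
    let (col , row , col-mono , row-mono , _ , fits) = gridded π Cπ in
    GriddedZigzag.length-bound M π π-zigzag col row col-mono row-mono fits N
      λ (σ , σ≼π , σ-alternation) → m+n≤o⇒m≤o _ (bounded σ (isClass σ π σ≼π Cπ) σ-alternation)

lemma3p2 : (C : PermSet) → IsClass C →
    FinitelyMany (C ∩Zigzag) ⇔ (MonotoneGriddable C × BoundedVerticalAlternations C)
lemma3p2 C isClass = mk⇔
  (λ finite → let bounded = finitelyMany⇒boundedLength (C ∩Zigzag) finite in
     boundedZigzags⇒monotoneGriddable C isClass bounded , boundedZigzags⇒boundedAlternations C bounded)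
  (λ (griddable , alternations) → boundedLength⇒finitelyMany (C ∩Zigzag)
     (griddable×boundedAlternations⇒boundedZigzags C isClass griddable alternations))
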